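{- Let $G$ be a finite simple connected graph and $T$ a finite tree. If $G$ has a hamiltonian coloring that has a quartet, then the cartesian product $G\times T$ also has a hamiltonian coloring that has a quartet.
   Context: All graphs are finite and simple. A $2$-coloring $C$ of $V(G)$ is a hamiltonian coloring of $G$ if each of the two color classes induces a tree in $G$ (in particular each class is nonempty). For $X\subseteq V(G)$, $C\Delta X$ denotes the $2$-coloring obtained from $C$ by switching the colors of the vertices in $X$. If $C$ is a hamiltonian coloring of $G$ and $I,J$ are disjoint $2$-element subsets of $V(G)$, the ordered pair $(I,J)$ is a quartet of $C$ if: (Q1) each of $I$ and $J$ contains one vertex of each color of $C$; (Q2) $C\Delta I$ is a hamiltonian coloring of $G$; (Q3) for each color, the set of vertices having that color in $C\Delta J$ induces in $G$ a forest with exactly two connected components, one of which contains a vertex of $I$ and the other contains a vertex of $J$. The cartesian product $G\times H$ has vertex set $V(G)\times V(H)$, with $(u,x)$ adjacent to $(v,y)$ iff either $x=y$ and $uv\in E(G)$, or $u=v$ and $xy\in E(H)$. -}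

module Defs where

open import Data.Nat using (ℕ; _*_; _≤_)
open import Data.Fin using (Fin; remQuot; _≟_)
open import Data.Bool using (Bool; true; false; not; if_then_else_; _∧_; _∨_)
open import Data.List using (List; []; _∷_; _++_; length)
open import Data.List.Relation.Unary.All using (All)
open import Data.List.Relation.Unary.Unique.Propositional using (Unique)
open import Data.List.Relation.Unary.Linked using (Linked)
open import Data.Product using (Σ; ∃; _×_; _,_; proj₁; proj₂)
open import Data.Sum using (_⊎_)
open import Data.Empty using (⊥)
open import Data.Unit using (⊤)
open import Relation.Nullary using (¬_)
open import Relation.Nullary.Decidable using (⌊_⌋)
open import Relation.Binary.PropositionalEquality using (_≡_; _≢_)

record Graph : Set where
  constructor mkGraph
  field
    n   : ℕ
    adj : Fin n → Fin n → Bool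

open Graph public

V : Graph → Set
V G = Fin (n G)

Adj : (G : Graph) → V G → V G → Set
Adj G u v = adj G u v ≡ true

IsSimple : Graph → Set
IsSimple G = (∀ u v → adj G u v ≡ adj G v u) × (∀ u → adj G u u ≡ false)

VSet : Graph → Set₁
VSet G = V G → Set

data Reach (G : Graph) (S : VSet G) : V G → V G → Set where
  here : ∀ {u} → S u → Reach G S u u
  step : ∀ {u w v} → S u → Adj G u w → Reach G S w v → Reach G S u v

HasCycle : (G : Graph) → VSet G → Set
HasCycle G S = Σ (V G) λ x → Σ (List (V G)) λ ys →
  (2 ≤ length ys) × Unique (x ∷ ys) × All S (x ∷ ys) ×
  Linked (Adj G) (x ∷ ys ++ x ∷ [])

InducesForest : (G : Graph) → VSet G → Set
InducesForest G S = ¬ HasCycle G S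

InducesTree : (G : Graph) → VSet G → Set
InducesTree G S = (Σ (V G) S) × (∀ u v → S u → S v → Reach G S u v) × InducesForest G S

AllV : (G : Graph) → VSet G
AllV G _ = ⊤

IsConnected : Graph → Set
IsConnected G = ∀ u v → Reach G (AllV G) u v

IsTree : Graph → Set
IsTree G = InducesTree G (AllV G)

Coloring : Graph → Set
Coloring G = V G → Bool

Class : (G : Graph) → Coloring G → Bool → VSet G
Class G C b v = C v ≡ b

IsHamiltonianColoring : (G : Graph) → Coloring G → Set
IsHamiltonianColoring G C = ∀ b → InducesTree G (Class G C b)

-- a 2-element subset {a, b} of V(G), represented by two distinct vertices
Pair : Graph → Set
Pair G = Σ (V G × V G) λ p → proj₁ p ≢ proj₂ p

InPair : (G : Graph) → Pair G → V G → Set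
InPair G ((a , b) , _) v = (v ≡ a) ⊎ (v ≡ b)

switch : (G : Graph) → Coloring G → Pair G → Coloring G
switch G C ((a , b) , _) v =
  if ⌊ v ≟ a ⌋ ∨ ⌊ v ≟ b ⌋ then not (C v) else C v

Disjoint : (G : Graph) → Pair G → Pair G → Set
Disjoint G I J = ∀ v → InPair G I v → InPair G J v → ⊥

TwoComponents : (G : Graph) → VSet G → Pair G → Pair G → Set
TwoComponents G S I J = InducesForest G S ×
  Σ (V G) λ a → Σ (V G) λ b →
    InPair G I a × InPair G J b × S a × S b × ¬ Reach G S a b ×
    (∀ v → S v → Reach G S v a ⊎ Reach G S v b)

IsQuartet : (G : Graph) → Coloring G → Pair G → Pair G → Set
IsQuartet G C I J =
  Disjoint G I J ×
  -- (Q1)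
  (C (proj₁ (proj₁ I)) ≢ C (proj₂ (proj₁ I))) ×
  (C (proj₁ (proj₁ J)) ≢ C (proj₂ (proj₁ J))) ×
  -- (Q2)
  IsHamiltonianColoring G (switch G C I) ×
  -- (Q3)
  (∀ b → TwoComponents G (Class G (switch G C J) b) I J)

HasHamColoringWithQuartet : Graph → Set
HasHamColoringWithQuartet G = Σ (Coloring G) λ C →
  IsHamiltonianColoring G C × Σ (Pair G) λ I → Σ (Pair G) λ J → IsQuartet G C I J

_×ᴳ_ : Graph → Graph → Graph
G ×ᴳ H = mkGraph (n G * n H) λ p q →
  let (u , x) = remQuot (n H) p
      (v , y) = remQuot (n H) q
  in (⌊ x ≟ y ⌋ ∧ adj G u v) ∨ (⌊ u ≟ v ⌋ ∧ adj H x y)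

-- Root T at a leaf r and pick another leaf r′ (if T is a single vertex, G × T is a copy of G).
-- Colour the copy G × {x} by C if x is at even distance from r, and by the complement of C Δ I
-- otherwise. A vertex has the same colour in two adjacent copies only if it lies in I, so the
-- b-classes of adjacent copies are joined by exactly one edge, at the vertex i_b of I of colour b,
-- and {i_b} × T connects them: every colour class is a tree.
-- The new quartet is (J × {r}, I × {r′}). Switching I × {r′} makes the colouring of the leaf copy
-- at r′ complementary to that of its neighbour, which cuts it off: this gives (Q3). Switching
-- J × {r} splits each class of the copy at r into the two components provided by (Q3) for G,
-- each attached to the rest by a single edge: this gives (Q2).
-- Acyclicity is always proved by projecting a cycle onto T: the copies it visits form a closed
-- walk in T without backtracking, and a tree has none.

module Submission where

open import Defs

open import Data.Bool using (Bool; true; false; not; if_then_else_; _∧_; _∨_)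
open import Data.Bool.Properties using (¬-not; not-¬; ∨-zeroʳ; not-involutive) renaming (_≟_ to _≟𝔹_)
open import Data.Empty using (⊥; ⊥-elim)
open import Data.Fin as Fin using (Fin; combine; remQuot) renaming (_≟_ to _≟ᶠ_)
open import Data.Fin.Properties using (any?; pigeonhole; remQuot-combine; combine-remQuot) renaming (<-irrefl to <ᶠ-irrefl)
open import Data.List using (List; []; _∷_; _++_; length; lookup; map)
open import Data.List.Properties using (length-++; ∷-injectiveʳ; length-map; map-++)
open import Data.List.Membership.Propositional using (_∈_)
open import Data.List.Membership.Propositional.Properties using (∈-∃++; ∈-++⁺ʳ)
open import Data.List.Relation.Unary.All as All using (All; []; _∷_)
import Data.List.Relation.Unary.All.Properties as Allₚ
open Allₚ using (¬Any⇒All¬)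
open import Data.List.Relation.Unary.Any using (here; there)
import Data.List.Relation.Unary.AllPairs as AllPairs
open import Data.List.Relation.Unary.Linked as Linked using (Linked; []; [-]; _∷_)
open import Data.List.Relation.Unary.Unique.Propositional using (Unique; []; _∷_)
open import Data.Nat using (zero; suc; _+_; _≤_; _<_; z≤n; s≤s; parity)
open import Data.Nat.Properties using (+-identityʳ; +-suc; n<1+n; m≤n⇒m≤1+n)
open import Data.Parity as ℙ using (Parity; 0ℙ; 1ℙ; _⁻¹)
open import Data.Parity.Properties using (⁻¹-involutive; +-homo-+; suc-homo-⁻¹)
open import Data.Product using (Σ; ∃; _×_; _,_; proj₁; proj₂)
open import Data.Sum as Sum using (_⊎_; inj₁; inj₂)
open import Data.Unit using (⊤; tt)
open import Data.Vec.Functional using (updateAt)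
open import Data.Vec.Functional.Properties using (updateAt-updates; updateAt-minimal)
open import Function using (_∘_; case_of_)
open import Relation.Binary.Definitions using (DecidableEquality)
open import Relation.Binary.PropositionalEquality
  using (_≡_; _≢_; refl; sym; trans; cong; cong₂; cong-app; subst; subst₂; module ≡-Reasoning)
open import Relation.Unary using (_⊆_; _≐_)
open import Relation.Nullary using (¬_; Dec; yes; no; ¬?)
open import Relation.Nullary.Decidable using (_×-dec_; ⌊_⌋; decidable-stable)

not-≡-swap : ∀ {a b} → not a ≡ b → a ≡ not b
not-≡-swap {a} e = trans (sym (not-involutive a)) (cong not e)

∨-≡-true : ∀ {a b} → a ∨ b ≡ true → a ≡ true ⊎ b ≡ true
∨-≡-true {true}  _ = inj₁ refl
∨-≡-true {false} e = inj₂ e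

∧-≡-true : ∀ {a b} → a ∧ b ≡ true → a ≡ true × b ≡ true
∧-≡-true {true} {true} _ = refl , refl

⌊⌋-true : ∀ {P : Set} (d : Dec P) → ⌊ d ⌋ ≡ true → P
⌊⌋-true (yes p) _ = p

⌊⌋-yes : ∀ {P : Set} (d : Dec P) → P → ⌊ d ⌋ ≡ true
⌊⌋-yes (yes _) _ = refl
⌊⌋-yes (no ¬p) p = ⊥-elim (¬p p)

⌊⌋-no : ∀ {P : Set} (d : Dec P) → ¬ P → ⌊ d ⌋ ≡ false
⌊⌋-no (yes p) ¬p = ⊥-elim (¬p p)
⌊⌋-no (no _)  _  = refl

parity-suc : ∀ n → parity (suc n) ≡ parity n ⁻¹
parity-suc n = trans (sym (⁻¹-involutive _)) (cong _⁻¹ (suc-homo-⁻¹ n))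

p+q≡0ℙ⇒p≡q : ∀ p q → p ℙ.+ q ≡ 0ℙ → p ≡ q
p+q≡0ℙ⇒p≡q 0ℙ 0ℙ _ = refl
p+q≡0ℙ⇒p≡q 1ℙ 1ℙ _ = refl

-- Walks as lists

module _ {A : Set} where

  NonBacktracking : List A → Set
  NonBacktracking (a ∷ b ∷ c ∷ t) = a ≢ c × NonBacktracking (b ∷ c ∷ t)
  NonBacktracking _               = ⊤

  NonBacktracking-tail : ∀ {a} t → NonBacktracking (a ∷ t) → NonBacktracking t
  NonBacktracking-tail []          _       = tt
  NonBacktracking-tail (_ ∷ [])    _       = tt
  NonBacktracking-tail (_ ∷ _ ∷ _) (_ , h) = h

  NonBacktracking-∷ʳ : ∀ a b c t {z} → NonBacktracking (a ∷ b ∷ c ∷ t) →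
                       All (_≢ z) (b ∷ c ∷ t) → NonBacktracking (a ∷ b ∷ c ∷ t ++ z ∷ [])
  NonBacktracking-∷ʳ a b c []      (a≢c , _) (b≢z ∷ _) = a≢c , b≢z , tt
  NonBacktracking-∷ʳ a b c (d ∷ t) (a≢c , h) (_ ∷ ≢z)  = a≢c , NonBacktracking-∷ʳ b c d t h ≢z

  endpoint : A → List A → A
  endpoint a []      = a
  endpoint _ (b ∷ t) = endpoint b t

  endpoint-∈ : ∀ a t → endpoint a t ∈ a ∷ t
  endpoint-∈ a []      = here refl
  endpoint-∈ a (b ∷ t) = there (endpoint-∈ b t)

  endpoint-∉ : ∀ {a b t} → Unique (a ∷ b ∷ t) → endpoint b t ≢ a
  endpoint-∉ {b = b} {t} (a∉ ∷ _) e = All.lookup a∉ (endpoint-∈ b t) (sym e)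

  endpoint-++ : ∀ P {x ys e d Q} → x ∷ ys ≡ P ++ e ∷ d ∷ Q → endpoint x ys ≡ endpoint d Q
  endpoint-++ []           refl = refl
  endpoint-++ (_ ∷ [])     refl = refl
  endpoint-++ (_ ∷ p ∷ P)  refl = endpoint-++ (p ∷ P) refl

  module _ {R : A → A → Set} where

    Linked-∷ʳ⁻ : ∀ x ys {z} → Linked R (x ∷ ys ++ z ∷ []) → Linked R (x ∷ ys) × R (endpoint x ys) z
    Linked-∷ʳ⁻ x []       (r ∷ _) = [-] , r
    Linked-∷ʳ⁻ x (y ∷ ys) (r ∷ l) = let l′ , r′ = Linked-∷ʳ⁻ y ys l in r ∷ l′ , r′

    Linked-∷ʳ⁺ : ∀ x ys {z} → Linked R (x ∷ ys) → R (endpoint x ys) z → Linked R (x ∷ ys ++ z ∷ [])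
    Linked-∷ʳ⁺ x []       _       r = r ∷ [-]
    Linked-∷ʳ⁺ x (y ∷ ys) (r ∷ l) r′ = r ∷ Linked-∷ʳ⁺ y ys l r′

    Linked-prefix : ∀ xs {y ys} → Linked R (xs ++ y ∷ ys) → Linked R (xs ++ y ∷ [])
    Linked-prefix []           _       = [-]
    Linked-prefix (_ ∷ [])     (r ∷ _) = r ∷ [-]
    Linked-prefix (_ ∷ x ∷ xs) (r ∷ l) = r ∷ Linked-prefix (x ∷ xs) l

    Linked-middle : ∀ P {e d Q} → Linked R (P ++ e ∷ d ∷ Q) → R e d
    Linked-middle []      l = Linked.head l
    Linked-middle (_ ∷ P) l = Linked-middle P (Linked.tail l)

  consecutive-first-last : ∀ P {e d Q x ys} → x ∷ ys ≡ P ++ e ∷ d ∷ Q → Unique (x ∷ ys) →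
                           e ≡ x → d ≡ endpoint x ys → 2 ≤ length ys → ⊥
  consecutive-first-last []      {Q = []}    refl _              _   _   (s≤s ())
  consecutive-first-last []      {Q = q ∷ Q} refl (_ ∷ d∉ ∷ _) _   d≡z _ = All.lookup d∉ (endpoint-∈ q Q) d≡z
  consecutive-first-last (_ ∷ P)              refl (x∉ ∷ _)     e≡x _   _ = All.head (Allₚ.++⁻ʳ P x∉) (sym e≡x)

  Unique-∉prefix : ∀ (P : List A) {a Q} → Unique (P ++ a ∷ Q) → All (a ≢_) P
  Unique-∉prefix []      _       = []
  Unique-∉prefix (_ ∷ P) (h ∷ u) = (λ a≡x → All.head (Allₚ.++⁻ʳ P h) (sym a≡x)) ∷ Unique-∉prefix P u

  Unique-prefix : ∀ (P : List A) {ys} → Unique (P ++ ys) → Unique P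
  Unique-prefix []      _         = []
  Unique-prefix (_ ∷ P) (h ∷ u)   = Allₚ.++⁻ˡ P h ∷ Unique-prefix P u

unique⇒length≤ : ∀ {m} (L : List (Fin m)) → Unique L → ¬ (m < length L)
unique⇒length≤ L u m<len with pigeonhole m<len (lookup L)
... | i , j , i<j , e = <ᶠ-irrefl (lookup-injective L u e) i<j
  where
  lookup-∈ : ∀ {B : Set} (L : List B) i → lookup L i ∈ L
  lookup-∈ (_ ∷ _) Fin.zero    = here refl
  lookup-∈ (_ ∷ L) (Fin.suc i) = there (lookup-∈ L i)
  lookup-injective : ∀ {B : Set} (L : List B) → Unique L → ∀ {i j} → lookup L i ≡ lookup L j → i ≡ j
  lookup-injective (_ ∷ L) _       {Fin.zero}  {Fin.zero}  _ = refl
  lookup-injective (_ ∷ L) (h ∷ _) {Fin.zero}  {Fin.suc j} e = ⊥-elim (All.lookup h (lookup-∈ L j) e)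
  lookup-injective (_ ∷ L) (h ∷ _) {Fin.suc i} {Fin.zero}  e = ⊥-elim (All.lookup h (lookup-∈ L i) (sym e))
  lookup-injective (_ ∷ L) (_ ∷ u) {Fin.suc i} {Fin.suc j} e = cong Fin.suc (lookup-injective L u e)

NonBacktrackingWalksArePaths : {W : Set} → (W → W → Set) → Set
NonBacktrackingWalksArePaths {W} E = ∀ (L : List W) → Linked E L → NonBacktracking L → Unique L

module Reduction {A : Set} (_≟_ : DecidableEquality A) where

  -- prepend the step a → b to a reduced walk starting at b, cancelling a backtrack a → b → a
  consReduced : A → A → List A → List A
  consReduced a b []      = b ∷ []
  consReduced a b (c ∷ t) with a ≟ c
  ... | yes _ = t
  ... | no  _ = b ∷ c ∷ t

  reduce : A → List A → List A
  reduce a []      = []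
  reduce a (b ∷ t) = consReduced a b (reduce b t)

  reduce-linked : ∀ {R : A → A → Set} a t → Linked R (a ∷ t) → Linked R (a ∷ reduce a t)
  reduce-linked a []      _       = [-]
  reduce-linked a (b ∷ t) (r ∷ l) = cons-linked (reduce b t) (reduce-linked b t l)
    where
    cons-linked : ∀ t → Linked _ (b ∷ t) → Linked _ (a ∷ consReduced a b t)
    cons-linked []      _ = r ∷ [-]
    cons-linked (c ∷ t) l with a ≟ c
    cons-linked (c ∷ t) (_ ∷ l) | yes refl = l
    ... | no _ = r ∷ l

  reduce-nonBacktracking : ∀ a t → NonBacktracking (a ∷ reduce a t)
  reduce-nonBacktracking a []      = tt
  reduce-nonBacktracking a (b ∷ t) = cons-nb (reduce b t) (reduce-nonBacktracking b t)
    where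
    cons-nb : ∀ t → NonBacktracking (b ∷ t) → NonBacktracking (a ∷ consReduced a b t)
    cons-nb []      _  = tt
    cons-nb (c ∷ t) nb with a ≟ c
    ... | yes refl = NonBacktracking-tail (c ∷ t) nb
    ... | no a≢c   = a≢c , nb

  reduce-endpoint : ∀ a t → endpoint a (reduce a t) ≡ endpoint a t
  reduce-endpoint a []      = refl
  reduce-endpoint a (b ∷ t) = trans (cons-endpoint (reduce b t)) (reduce-endpoint b t)
    where
    cons-endpoint : ∀ t → endpoint a (consReduced a b t) ≡ endpoint b t
    cons-endpoint []      = refl
    cons-endpoint (c ∷ t) with a ≟ c
    ... | yes refl = refl
    ... | no _     = refl

  reduce-parity : ∀ a t → parity (length (reduce a t)) ≡ parity (length t)
  reduce-parity a []      = refl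
  reduce-parity a (b ∷ t) = begin
    parity (length (consReduced a b (reduce b t)))  ≡⟨ cons-parity (reduce b t) ⟩
    parity (suc (length (reduce b t)))              ≡⟨ parity-suc (length (reduce b t)) ⟩
    parity (length (reduce b t)) ⁻¹                 ≡⟨ cong _⁻¹ (reduce-parity b t) ⟩
    parity (length t) ⁻¹                            ≡⟨ parity-suc (length t) ⟨
    parity (suc (length t))                         ∎
    where
    cons-parity : ∀ t → parity (length (consReduced a b t)) ≡ parity (suc (length t))
    cons-parity []      = refl
    cons-parity (c ∷ t) with a ≟ c
    ... | yes _ = refl
    ... | no _  = refl
    open ≡-Reasoning

-- Graphs, pairs and switching

module _ (G : Graph) where

  Reach-trans : ∀ {S u v w} → Reach G S u v → Reach G S v w → Reach G S u w
  Reach-trans (here _)     q = q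
  Reach-trans (step s a p) q = step s a (Reach-trans p q)

  Reach-mono : ∀ {S S′ : VSet G} → S ⊆ S′ → ∀ {u v} → Reach G S u v → Reach G S′ u v
  Reach-mono S⊆S′ (here s)     = here (S⊆S′ s)
  Reach-mono S⊆S′ (step s a p) = step (S⊆S′ s) a (Reach-mono S⊆S′ p)

  Reach-∷ʳ : ∀ {S u v w} → Reach G S u v → Adj G v w → S w → Reach G S u w
  Reach-∷ʳ (here s)     a sw = step s a (here sw)
  Reach-∷ʳ (step s a p) b sw = step s a (Reach-∷ʳ p b sw)

  Reach-sym : (∀ {u v} → Adj G u v → Adj G v u) → ∀ {S u v} → Reach G S u v → Reach G S v u
  Reach-sym adj-sym (here s)     = here s
  Reach-sym adj-sym (step s a p) = Reach-∷ʳ (Reach-sym adj-sym p) (adj-sym a) s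

  Reach-invariant : ∀ {S : VSet G} (Q : VSet G) → (∀ {p q} → S p → S q → Adj G p q → Q p → Q q) →
                    ∀ {p q} → Reach G S p q → Q p → Q q
  Reach-invariant Q step-Q (here _)     qp = qp
  Reach-invariant Q step-Q (step s a p) qp = Reach-invariant Q step-Q p (step-Q s (reach-source p) a qp)
    where
    reach-source : ∀ {S u v} → Reach G S u v → S u
    reach-source (here s)     = s
    reach-source (step s _ _) = s

  hub-tree : (∀ {u v} → Adj G u v → Adj G v u) → ∀ {S h} → S h → (∀ {u} → S u → Reach G S u h) →
             InducesForest G S → InducesTree G S
  hub-tree adj-sym sh to-hub forest =
    (_ , sh) , (λ u v su sv → Reach-trans (to-hub su) (Reach-sym adj-sym (to-hub sv))) , forest

  walk : ∀ {S u v} → Reach G S u v → List (V G)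
  walk (here _)              = []
  walk (step {w = w} _ _ p) = w ∷ walk p

  walk-trans : ∀ {S u v w} (p : Reach G S u v) (q : Reach G S v w) → walk (Reach-trans p q) ≡ walk p ++ walk q
  walk-trans (here _)     q = refl
  walk-trans (step _ _ p) q = cong (_ ∷_) (walk-trans p q)

  walk-linked : ∀ {S u v} (p : Reach G S u v) → Linked (Adj G) (u ∷ walk p)
  walk-linked (here _)     = [-]
  walk-linked (step _ a p) = a ∷ walk-linked p

  walk-endpoint : ∀ {S u v} (p : Reach G S u v) → endpoint u (walk p) ≡ v
  walk-endpoint (here _)     = refl
  walk-endpoint (step _ _ p) = walk-endpoint p

  fromWalk : ∀ {S} u t → Linked (Adj G) (u ∷ t) → All S (u ∷ t) → Reach G S u (endpoint u t)
  fromWalk u []      _       (s ∷ []) = here s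
  fromWalk u (b ∷ t) (a ∷ l) (s ∷ ss) = step s a (fromWalk b t l ss)

  InducesForest-anti : ∀ {S S′ : VSet G} → S ⊆ S′ → InducesForest G S′ → InducesForest G S
  InducesForest-anti S⊆S′ forest (x , ys , 2≤ , u , ss , l) = forest (x , ys , 2≤ , u , All.map S⊆S′ ss , l)

  class-resp : ∀ {c c′ : Coloring G} → (∀ v → c v ≡ c′ v) → ∀ b → Class G c b ≐ Class G c′ b
  class-resp c≗c′ b = (λ {v} e → trans (sym (c≗c′ v)) e) , (λ {v} e → trans (c≗c′ v) e)

  InducesTree-resp : ∀ {S S′ : VSet G} → S ≐ S′ → InducesTree G S → InducesTree G S′
  InducesTree-resp (S⊆S′ , S′⊆S) ((v , s) , connected , forest) =
    (v , S⊆S′ s) ,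
    (λ u w su sw → Reach-mono S⊆S′ (connected u w (S′⊆S su) (S′⊆S sw))) ,
    InducesForest-anti S′⊆S forest

  TwoComponents-resp : ∀ {S S′ : VSet G} {I J} → S ≐ S′ → TwoComponents G S I J → TwoComponents G S′ I J
  TwoComponents-resp (S⊆S′ , S′⊆S) (forest , a , b , aI , bJ , sa , sb , a↛b , toAB) =
    InducesForest-anti S′⊆S forest , a , b , aI , bJ , S⊆S′ sa , S⊆S′ sb ,
    (λ p → a↛b (Reach-mono S′⊆S p)) ,
    λ v sv → Sum.map (Reach-mono S⊆S′) (Reach-mono S⊆S′) (toAB v (S′⊆S sv))

  module _ (irreflexive : ∀ {u} → ¬ Adj G u u) where
    open import Data.List.Membership.DecPropositional (_≟ᶠ_ {n G}) using (_∈?_)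

    nonBacktracking⇒unique⊎cycle : ∀ {S} L → Linked (Adj G) L → NonBacktracking L → All S L →
                                   Unique L ⊎ HasCycle G S
    nonBacktracking⇒unique⊎cycle []       _ _  _        = inj₁ []
    nonBacktracking⇒unique⊎cycle (a ∷ L) l nb (s ∷ ss)
      with nonBacktracking⇒unique⊎cycle L (Linked.tail l) (NonBacktracking-tail L nb) ss
    ... | inj₂ cycle = inj₂ cycle
    ... | inj₁ u with a ∈? L
    ...   | no a∉L = inj₁ (¬Any⇒All¬ L a∉L ∷ u)
    ...   | yes a∈L with ∈-∃++ a∈L
    ...     | P , Q , refl = inj₂ (a , P , 2≤ P l nb , a∉P ∷ Unique-prefix P u ,
                                   s ∷ Allₚ.++⁻ˡ P ss , Linked-prefix (a ∷ P) l)
      where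
      a∉P : All (a ≢_) P
      a∉P = Unique-∉prefix P u
      2≤ : ∀ P → Linked (Adj G) (a ∷ P ++ a ∷ Q) → NonBacktracking (a ∷ P ++ a ∷ Q) → 2 ≤ length P
      2≤ []          (r ∷ _) _        = ⊥-elim (irreflexive r)
      2≤ (_ ∷ [])    _       (a≢a , _) = ⊥-elim (a≢a refl)
      2≤ (_ ∷ _ ∷ _) _       _        = s≤s (s≤s z≤n)

module _ {G : Graph} where

  simple⇒irreflexive : IsSimple G → ∀ {u} → ¬ Adj G u u
  simple⇒irreflexive (_ , irr) {u} a with trans (sym a) (irr u)
  ... | ()

  simple⇒symmetric : IsSimple G → ∀ {u v} → Adj G u v → Adj G v u
  simple⇒symmetric (adj-sym , _) {u} {v} a = trans (adj-sym v u) a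

Leaf : (G : Graph) → V G → V G → Set
Leaf G ℓ s = Adj G ℓ s × (∀ y → Adj G ℓ y → y ≡ s)

nonBacktracking-avoids-leaf : ∀ {G r s} → Leaf G r s → (∀ {u v} → Adj G u v → Adj G v u) →
  ∀ a t → Linked (Adj G) (a ∷ t) → NonBacktracking (a ∷ t) → a ≢ r → endpoint a t ≢ r → All (_≢ r) (a ∷ t)
nonBacktracking-avoids-leaf leaf sym-adj a []          _ _ a≢r _ = a≢r ∷ []
nonBacktracking-avoids-leaf leaf sym-adj a (b ∷ [])    _ _ a≢r end≢r = a≢r ∷ end≢r ∷ []
nonBacktracking-avoids-leaf {r = r} leaf sym-adj a (b ∷ c ∷ t) (a~b ∷ l) (a≢c , nb) a≢r end≢r =
  a≢r ∷ nonBacktracking-avoids-leaf leaf sym-adj b (c ∷ t) l nb b≢r end≢r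
  where
  b≢r : b ≢ r
  b≢r refl = a≢c (trans (proj₂ leaf a (sym-adj a~b)) (sym (proj₂ leaf c (Linked.head l))))

module _ (H : Graph) where

  inPair? : ∀ (P : Pair H) v → Dec (InPair H P v)
  inPair? ((a , b) , _) v with v ≟ᶠ a | v ≟ᶠ b
  ... | yes v≡a | _       = yes (inj₁ v≡a)
  ... | no _    | yes v≡b = yes (inj₂ v≡b)
  ... | no v≢a  | no v≢b  = no λ { (inj₁ v≡a) → v≢a v≡a ; (inj₂ v≡b) → v≢b v≡b }

  switch-in : ∀ c (P : Pair H) {v} → InPair H P v → switch H c P v ≡ not (c v)
  switch-in c ((a , b) , _) {v} (inj₁ refl) rewrite ⌊⌋-yes (v ≟ᶠ v) refl = refl
  switch-in c ((a , b) , _) {v} (inj₂ refl) rewrite ⌊⌋-yes (v ≟ᶠ v) refl | ∨-zeroʳ ⌊ v ≟ᶠ a ⌋ = refl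

  switch-out : ∀ c (P : Pair H) {v} → ¬ InPair H P v → switch H c P v ≡ c v
  switch-out c ((a , b) , _) {v} v∉P
    rewrite ⌊⌋-no (v ≟ᶠ a) (v∉P ∘ inj₁) | ⌊⌋-no (v ≟ᶠ b) (v∉P ∘ inj₂) = refl

  Separates : Coloring H → Pair H → Set
  Separates c ((a , b) , _) = c a ≢ c b

  separated-unique : ∀ c (P : Pair H) → Separates c P → ∀ {u v} → InPair H P u → InPair H P v → c u ≡ c v → u ≡ v
  separated-unique c P _   (inj₁ refl) (inj₁ refl) _ = refl
  separated-unique c P _   (inj₂ refl) (inj₂ refl) _ = refl
  separated-unique c P sep (inj₁ refl) (inj₂ refl) e = ⊥-elim (sep e)
  separated-unique c P sep (inj₂ refl) (inj₁ refl) e = ⊥-elim (sep (sym e))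

  member : Coloring H → Pair H → Bool → V H
  member c ((a , b′) , _) b = if ⌊ c a ≟𝔹 b ⌋ then a else b′

  member-∈ : ∀ c P b → InPair H P (member c P b)
  member-∈ c ((a , _) , _) b with c a ≟𝔹 b
  ... | yes _ = inj₁ refl
  ... | no _  = inj₂ refl

  member-color : ∀ c P → Separates c P → ∀ b → c (member c P b) ≡ b
  member-color c ((a , _) , _) sep b with c a ≟𝔹 b
  ... | yes ca≡b = ca≡b
  ... | no ca≢b  = trans (¬-not (sep ∘ sym)) (trans (cong not (¬-not ca≢b)) (not-involutive b))

  member-unique : ∀ c P → Separates c P → ∀ {u b} → InPair H P u → c u ≡ b → u ≡ member c P b
  member-unique c P sep {b = b} u∈P cu≡b =
    separated-unique c P sep u∈P (member-∈ c P b) (trans cu≡b (sym (member-color c P sep b)))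

-- Trees

module Tree (T : Graph) (simple : IsSimple T) (tree : IsTree T) where
  open Reduction (_≟ᶠ_ {n T})

  private
    sym-adj : ∀ {x y} → Adj T x y → Adj T y x
    sym-adj = simple⇒symmetric simple

  connected : ∀ x y → Reach T (AllV T) x y
  connected x y = proj₁ (proj₂ tree) x y tt tt

  nonBacktracking⇒unique : ∀ L → Linked (Adj T) L → NonBacktracking L → Unique L
  nonBacktracking⇒unique L l nb
    with nonBacktracking⇒unique⊎cycle T (simple⇒irreflexive simple) L l nb (All.universal (λ _ → tt) L)
  ... | inj₁ u     = u
  ... | inj₂ cycle = ⊥-elim (proj₂ (proj₂ tree) cycle)

  reduce-closed : ∀ x t → Linked (Adj T) (x ∷ t) → endpoint x t ≡ x → reduce x t ≡ []
  reduce-closed x t l closed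
    with reduce x t | reduce-linked x t l | reduce-nonBacktracking x t | reduce-endpoint x t
  ... | []    | _  | _  | _ = refl
  ... | _ ∷ _ | l′ | nb | e = ⊥-elim (endpoint-∉ (nonBacktracking⇒unique _ l′ nb) (trans e closed))

  closedWalk-even : ∀ {x} (w : Reach T (AllV T) x x) → parity (length (walk T w)) ≡ 0ℙ
  closedWalk-even {x} w = begin
    parity (length (walk T w))            ≡⟨ reduce-parity x (walk T w) ⟨
    parity (length (reduce x (walk T w))) ≡⟨ cong (parity ∘ length) (reduce-closed x _ (walk-linked T w) (walk-endpoint T w)) ⟩
    0ℙ                                    ∎
    where open ≡-Reasoning

  closedWalk-parity : ∀ {x y} (p : Reach T (AllV T) x y) (q : Reach T (AllV T) y x) →
                      parity (length (walk T p)) ℙ.+ parity (length (walk T q)) ≡ 0ℙ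
  closedWalk-parity p q = begin
    parity (length (walk T p)) ℙ.+ parity (length (walk T q)) ≡⟨ +-homo-+ (length (walk T p)) _ ⟨
    parity (length (walk T p) + length (walk T q))           ≡⟨ cong parity (length-++ (walk T p)) ⟨
    parity (length (walk T p ++ walk T q))                   ≡⟨ cong (parity ∘ length) (walk-trans T p q) ⟨
    parity (length (walk T (Reach-trans T p q)))             ≡⟨ closedWalk-even (Reach-trans T p q) ⟩
    0ℙ                                                       ∎
    where open ≡-Reasoning

  module Rooted (r : V T) where

    side : V T → Parity
    side x = parity (length (walk T (connected r x)))

    side-root : side r ≡ 0ℙ
    side-root = closedWalk-even (connected r r)

    side-adj : ∀ {x y} → Adj T x y → side y ≡ side x ⁻¹
    side-adj {x} {y} a = begin
      side y       ≡⟨ p+q≡0ℙ⇒p≡q _ _ (closedWalk-parity (connected r y) (connected y r)) ⟩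
      back         ≡⟨ ⁻¹-involutive back ⟨
      back ⁻¹ ⁻¹   ≡⟨ cong _⁻¹ (p+q≡0ℙ⇒p≡q _ _ x-closed) ⟨
      side x ⁻¹    ∎
      where
      open ≡-Reasoning
      back = parity (length (walk T (connected y r)))
      x-closed : side x ℙ.+ back ⁻¹ ≡ 0ℙ
      x-closed = trans (cong (side x ℙ.+_) (sym (parity-suc (length (walk T (connected y r))))))
                       (closedWalk-parity (connected r x) (step tt a (connected y r)))

  leaf-beyond : ∀ {p c} → Adj T p c → Σ (V T) λ ℓ → Σ (V T) λ s → Leaf T ℓ s × ℓ ≢ p
  leaf-beyond {p} {c} a with extend (n T) c p [] (sym-adj a ∷ [-]) tt (m≤n⇒m≤1+n (n<1+n (n T)))
    where
    -- k is fuel: c ∷ p ∷ rest is a path in T, so it has at most n T vertices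
    extend : ∀ k c p rest → Linked (Adj T) (c ∷ p ∷ rest) → NonBacktracking (c ∷ p ∷ rest) →
             n T < length (c ∷ p ∷ rest) + k →
             Σ (V T) λ ℓ → Σ (V T) λ s → Leaf T ℓ s × All (ℓ ≢_) (p ∷ rest)
    extend zero c p rest l nb lt =
      ⊥-elim (unique⇒length≤ _ (nonBacktracking⇒unique _ l nb) (subst (n T <_) (+-identityʳ _) lt))
    extend (suc k) c p rest l nb lt with any? (λ y → (adj T c y ≟𝔹 true) ×-dec ¬? (y ≟ᶠ p))
    ... | yes (y , c~y , y≢p) =
      let ℓ , s , leaf , ℓ∉ = extend k y c (p ∷ rest) (sym-adj c~y ∷ l) (y≢p , nb) (subst (n T <_) (+-suc _ k) lt)
      in ℓ , s , leaf , All.tail ℓ∉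
    ... | no stuck = c , p , (Linked.head l , only-p) , AllPairs.head (nonBacktracking⇒unique _ l nb)
      where
      only-p : ∀ y → Adj T c y → y ≡ p
      only-p y c~y with y ≟ᶠ p
      ... | yes y≡p = y≡p
      ... | no y≢p  = ⊥-elim (stuck (y , c~y , y≢p))
  ... | ℓ , s , leaf , ℓ∉ = ℓ , s , leaf , All.head ℓ∉

  twoLeaves : ∀ {x y} → x ≢ y → Σ (V T) λ r → Σ (V T) λ s → Σ (V T) λ r′ → Σ (V T) λ s′ →
              Leaf T r s × Leaf T r′ s′ × r ≢ r′
  twoLeaves {x} {y} x≢y with connected x y
  ... | here _        = ⊥-elim (x≢y refl)
  ... | step _ x~w _ with leaf-beyond x~w
  ...   | r′ , s′ , leaf′ , _ with leaf-beyond (proj₁ leaf′)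
  ...     | r , s , leaf , r≢r′ = r , s , r′ , s′ , leaf , leaf′ , r≢r′

  avoidLeaf : ∀ {r s} → Leaf T r s → ∀ {x y} → x ≢ r → y ≢ r → Reach T (_≢ r) x y
  avoidLeaf leaf {x} {y} x≢r y≢r = subst (Reach T _ x) end (fromWalk T x t′ l′ avoids)
    where
    w   = connected x y
    t′  = reduce x (walk T w)
    l′  = reduce-linked x (walk T w) (walk-linked T w)
    end : endpoint x t′ ≡ y
    end = trans (reduce-endpoint x (walk T w)) (walk-endpoint T w)
    avoids = nonBacktracking-avoids-leaf leaf sym-adj x t′ l′ (reduce-nonBacktracking x (walk T w)) x≢r
               (λ e → y≢r (trans (sym end) e))

-- Acyclicity by projection onto a tree

module Fibration (H : Graph) (sym-adj : ∀ {p q} → Adj H p q → Adj H q p) (S : VSet H)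
  {W : Set} (_≟ʷ_ : DecidableEquality W) (E : W → W → Set) (f : V H → W) where

  Fibre : W → VSet H
  Fibre w p = S p × f p ≡ w

  compress : W → List W → List W
  compress w []        = []
  compress w (w′ ∷ ws) with w ≟ʷ w′
  ... | yes _ = compress w ws
  ... | no  _ = w′ ∷ compress w′ ws

  compress-≡ : ∀ {w w′ ws} → w ≡ w′ → compress w (w′ ∷ ws) ≡ compress w ws
  compress-≡ {w} {w′} w≡w′ with w ≟ʷ w′
  ... | yes _    = refl
  ... | no w≢w′ = ⊥-elim (w≢w′ w≡w′)

  compress-≢ : ∀ {w w′ ws} → w ≢ w′ → compress w (w′ ∷ ws) ≡ w′ ∷ compress w′ ws
  compress-≢ {w} {w′} w≢w′ with w ≟ʷ w′
  ... | yes w≡w′ = ⊥-elim (w≢w′ w≡w′)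
  ... | no _     = refl

  compress-endpoint : ∀ w ws → endpoint w (compress w ws) ≡ endpoint w ws
  compress-endpoint w []        = refl
  compress-endpoint w (w′ ∷ ws) with w ≟ʷ w′
  ... | yes refl = compress-endpoint w ws
  ... | no _     = compress-endpoint w′ ws

  compress-[] : ∀ w ws → compress w ws ≡ [] → All (_≡ w) ws
  compress-[] w []        _ = []
  compress-[] w (w′ ∷ ws) e with w ≟ʷ w′
  ... | yes refl = refl ∷ compress-[] w ws e
  compress-[] w (w′ ∷ ws) () | no _

  endpoint-map : ∀ x ys → endpoint (f x) (map f ys) ≡ f (endpoint x ys)
  endpoint-map x []       = refl
  endpoint-map x (y ∷ ys) = endpoint-map y ys

  record Exit (w : W) (b : V H) (cs : List (V H)) : Set where
    constructor exit
    field
      before : List (V H)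
      last   : V H
      next   : V H
      after  : List (V H)
      split  : b ∷ cs ≡ before ++ last ∷ next ∷ after
      inside : All (λ v → f v ≡ w) (before ++ last ∷ [])
      leaves : f next ≢ w
      compress-split : compress w (map f cs) ≡ f next ∷ compress (f next) (map f after)

  firstExit : ∀ w b cs → f b ≡ w → compress w (map f cs) ≡ [] ⊎ Exit w b cs
  firstExit w b []        _   = inj₁ refl
  firstExit w b (c ∷ cs) fb≡w with w ≟ʷ f c
  ... | no w≢fc = inj₂ (exit [] b c cs refl (fb≡w ∷ []) (w≢fc ∘ sym) (compress-≢ w≢fc))
  ... | yes w≡fc with firstExit w c cs (sym w≡fc)
  ...   | inj₁ e = inj₁ e
  ...   | inj₂ (exit P e d Q split inside leaves cs-split) =
            inj₂ (exit (b ∷ P) e d Q (cong (b ∷_) split) (fb≡w ∷ inside) leaves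
                       (trans (compress-≡ w≡fc) cs-split))

  module _ (edge-projects : ∀ {p q} → S p → S q → Adj H p q → f p ≡ f q ⊎ E (f p) (f q))
           (crossing-unique : ∀ {p q p′ q′} → S p → S q → S p′ → S q′ → Adj H p q → Adj H p′ q′ →
                              f p ≡ f p′ → f q ≡ f q′ → f p ≢ f q → p ≡ p′ × q ≡ q′) where

    compress-linked : ∀ x ys → Linked (Adj H) (x ∷ ys) → All S (x ∷ ys) → Linked E (f x ∷ compress (f x) (map f ys))
    compress-linked x []       _       _              = [-]
    compress-linked x (y ∷ ys) (a ∷ l) (sx ∷ sy ∷ ss) with f x ≟ʷ f y
    ... | yes fx≡fy rewrite fx≡fy = compress-linked y ys l (sy ∷ ss)
    ... | no fx≢fy with edge-projects sx sy a
    ...   | inj₁ fx≡fy = ⊥-elim (fx≢fy fx≡fy)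
    ...   | inj₂ e     = e ∷ compress-linked y ys l (sy ∷ ss)

    compress-nonBacktracking : ∀ b cs → Unique (b ∷ cs) → Linked (Adj H) (b ∷ cs) → All S (b ∷ cs) →
                               NonBacktracking (f b ∷ compress (f b) (map f cs))
    compress-nonBacktracking b []       _         _ _         = tt
    compress-nonBacktracking b (c ∷ cs) (b∉ ∷ u) l (sb ∷ ss) with f b ≟ʷ f c
    ... | yes fb≡fc rewrite fb≡fc = compress-nonBacktracking c cs u (Linked.tail l) ss
    ... | no fb≢fc with compress-nonBacktracking c cs u (Linked.tail l) ss | firstExit (f c) c cs refl
    ...   | nb | inj₁ e rewrite e = tt
    ...   | nb | inj₂ (exit P e d Q split inside _ cs-split) rewrite cs-split = fb≢fd , nb
      where
      ss′ = Allₚ.++⁻ʳ P (subst (All S) split ss)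
      d~e : Adj H d e
      d~e = sym-adj (Linked-middle P (subst (Linked (Adj H)) split (Linked.tail l)))
      b≢d : b ≢ d
      b≢d = All.head (All.tail (Allₚ.++⁻ʳ P (subst (All (b ≢_)) split b∉)))
      fb≢fd : f b ≢ f d
      fb≢fd fb≡fd = b≢d (proj₁ (crossing-unique sb (All.head ss) (All.head (All.tail ss′)) (All.head ss′)
                                  (Linked.head l) d~e fb≡fd (sym (All.head (Allₚ.++⁻ʳ P inside))) fb≢fc))

    single-excursion-impossible : ∀ {x ys w} → Linked (Adj H) (x ∷ ys ++ x ∷ []) → Unique (x ∷ ys) → All S (x ∷ ys) →
                                  2 ≤ length ys → compress (f x) (map f ys) ≢ w ∷ []
    single-excursion-impossible {x} {ys} l u ss 2≤ eq with firstExit (f x) x ys refl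
    ... | inj₁ e = case trans (sym e) eq of λ ()
    ... | inj₂ (exit P e d Q split inside leaves cs-split) =
      consecutive-first-last P split u (proj₁ e≡x×d≡z) (proj₂ e≡x×d≡z) 2≤
      where
      z   = endpoint x ys
      ss′ = Allₚ.++⁻ʳ P (subst (All S) split ss)
      fe≡fx : f e ≡ f x
      fe≡fx = All.head (Allₚ.++⁻ʳ P inside)
      fQ≡fd : All (λ v → f v ≡ f d) Q
      fQ≡fd = Allₚ.map⁻ (compress-[] (f d) (map f Q) (∷-injectiveʳ (trans (sym cs-split) eq)))
      fd≡fz : f d ≡ f z
      fd≡fz = sym (All.lookup (refl ∷ fQ≡fd) (subst (_∈ d ∷ Q) (sym (endpoint-++ P split)) (endpoint-∈ d Q)))
      e≡x×d≡z : e ≡ x × d ≡ z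
      e≡x×d≡z = crossing-unique (All.head ss′) (All.head (All.tail ss′)) (All.head ss) (All.lookup ss (endpoint-∈ x ys))
                  (Linked-middle P (subst (Linked (Adj H)) split (proj₁ (Linked-∷ʳ⁻ x ys l))))
                  (sym-adj (proj₂ (Linked-∷ʳ⁻ x ys l)))
                  fe≡fx fd≡fz (λ fe≡fd → leaves (trans (sym fe≡fd) fe≡fx))

    -- The fibres visited by a cycle form a closed walk in E which, by crossing-uniqueness, does not
    -- backtrack; since such walks are paths, the cycle lies in a single fibre.
    module _ (E-paths : NonBacktrackingWalksArePaths E)
             (fibres-acyclic : ∀ w → InducesForest H (Fibre w)) where

      fibration-forest : InducesForest H S
      fibration-forest (x , ys , 2≤ , u , ss , l)
        with compress (f x) (map f ys) in eq
           | compress-linked x ys path ss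
           | compress-nonBacktracking x ys u path ss
           | trans (compress-endpoint (f x) (map f ys)) (endpoint-map x ys)
        where
        path = proj₁ (Linked-∷ʳ⁻ x ys l)
      ... | [] | _ | _ | _ =
        fibres-acyclic (f x) (x , ys , 2≤ , u , All.zip (ss , refl ∷ Allₚ.map⁻ (compress-[] (f x) (map f ys) eq)) , l)
      ... | _ ∷ [] | _ | _ | _ = single-excursion-impossible l u ss 2≤ eq
      ... | w₁ ∷ w₂ ∷ L | l′ | nb | end with E-paths _ l′ nb | f (endpoint x ys) ≟ʷ f x
      ...   | un | yes fz≡fx = endpoint-∉ un (trans end fz≡fx)
      ...   | un | no fz≢fx
        with edge-projects (All.lookup ss (endpoint-∈ x ys)) (All.head ss) (proj₂ (Linked-∷ʳ⁻ x ys l))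
      ...     | inj₁ fz≡fx = fz≢fx fz≡fx
      ...     | inj₂ z→x = All.lookup (AllPairs.head closed-unique) (∈-++⁺ʳ (w₁ ∷ w₂ ∷ L) (here refl)) refl
        where
        closed-unique : Unique (f x ∷ w₁ ∷ w₂ ∷ L ++ f x ∷ [])
        closed-unique = E-paths _
          (Linked-∷ʳ⁺ (f x) (w₁ ∷ w₂ ∷ L) l′ (subst (λ t → E t (f x)) (sym end) z→x))
          (NonBacktracking-∷ʳ (f x) w₁ w₂ L nb (All.map (_∘ sym) (AllPairs.head un)))

forest-glue : ∀ (H : Graph) → (∀ {p q} → Adj H p q → Adj H q p) → ∀ (S : VSet H) (g : V H → Bool) →
  InducesForest H (λ p → S p × g p ≡ true) → InducesForest H (λ p → S p × g p ≡ false) →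
  (∀ {p q p′ q′} → S p → S q → S p′ → S q′ → Adj H p q → Adj H p′ q′ →
     g p ≡ true → g q ≡ false → g p′ ≡ true → g q′ ≡ false → p ≡ p′ × q ≡ q′) →
  InducesForest H S
forest-glue H sym-adj S g forest-true forest-false one-bridge =
  fibration-forest edge-projects crossing-unique Bool-paths fibres
  where
  open Fibration H sym-adj S _≟𝔹_ _≢_ g

  edge-projects : ∀ {p q} → S p → S q → Adj H p q → g p ≡ g q ⊎ g p ≢ g q
  edge-projects {p} {q} _ _ _ with g p ≟𝔹 g q
  ... | yes gp≡gq = inj₁ gp≡gq
  ... | no gp≢gq  = inj₂ gp≢gq

  crossing-unique : ∀ {p q p′ q′} → S p → S q → S p′ → S q′ → Adj H p q → Adj H p′ q′ →
                    g p ≡ g p′ → g q ≡ g q′ → g p ≢ g q → p ≡ p′ × q ≡ q′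
  crossing-unique {p} {q} sp sq sp′ sq′ a a′ e e′ gp≢gq with g p in gp | g q in gq
  ... | true  | true  = ⊥-elim (gp≢gq refl)
  ... | false | false = ⊥-elim (gp≢gq refl)
  ... | true  | false = one-bridge sp sq sp′ sq′ a a′ gp gq (sym e) (sym e′)
  ... | false | true  = let q≡q′ , p≡p′ = one-bridge sq sp sq′ sp′ (sym-adj a) (sym-adj a′) gq gp (sym e′) (sym e)
                        in p≡p′ , q≡q′

  Bool-paths : NonBacktrackingWalksArePaths {Bool} _≢_
  Bool-paths []                _               _         = []
  Bool-paths (_ ∷ [])          _               _         = [] ∷ []
  Bool-paths (_ ∷ _ ∷ [])      (a≢b ∷ _)       _         = (a≢b ∷ []) ∷ [] ∷ []
  Bool-paths (a ∷ b ∷ c ∷ _)   (a≢b ∷ b≢c ∷ _) (a≢c , _) =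
    ⊥-elim (a≢c (trans (¬-not a≢b) (sym (¬-not (b≢c ∘ sym)))))

  fibres : ∀ w → InducesForest H (Fibre w)
  fibres true  = forest-true
  fibres false = forest-false

-- Cartesian products

module Product (G T : Graph) (simpleG : IsSimple G) (simpleT : IsSimple T) (treeT : IsTree T) where

  K : Graph
  K = G ×ᴳ T

  ⟦_,_⟧ : V G → V T → V K
  ⟦ u , x ⟧ = combine {n G} {n T} u x

  πG : V K → V G
  πG p = proj₁ (remQuot {n G} (n T) p)

  πT : V K → V T
  πT p = proj₂ (remQuot {n G} (n T) p)

  πG-⟦⟧ : ∀ u x → πG ⟦ u , x ⟧ ≡ u
  πG-⟦⟧ u x = cong proj₁ (remQuot-combine {n G} {n T} u x)

  πT-⟦⟧ : ∀ u x → πT ⟦ u , x ⟧ ≡ x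
  πT-⟦⟧ u x = cong proj₂ (remQuot-combine {n G} {n T} u x)

  ⟦π⟧ : ∀ p → ⟦ πG p , πT p ⟧ ≡ p
  ⟦π⟧ p = combine-remQuot {n G} (n T) p

  π-injective : ∀ {p q} → πG p ≡ πG q → πT p ≡ πT q → p ≡ q
  π-injective {p} {q} eG eT = trans (sym (⟦π⟧ p)) (trans (cong₂ ⟦_,_⟧ eG eT) (⟦π⟧ q))

  edge : V G × V T → V G × V T → Bool
  edge (u , x) (v , y) = (⌊ x ≟ᶠ y ⌋ ∧ adj G u v) ∨ (⌊ u ≟ᶠ v ⌋ ∧ adj T x y)

  adj-⟦⟧ : ∀ u x v y → adj K ⟦ u , x ⟧ ⟦ v , y ⟧ ≡ edge (u , x) (v , y)
  adj-⟦⟧ u x v y = cong₂ edge (remQuot-combine {n G} {n T} u x) (remQuot-combine {n G} {n T} v y)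

  ⟦π⟧-at : ∀ {p x} → πT p ≡ x → ⟦ πG p , x ⟧ ≡ p
  ⟦π⟧-at {p} e = trans (cong (λ y → ⟦ πG p , y ⟧) (sym e)) (⟦π⟧ p)

  adj-split : ∀ {p q} → Adj K p q →
              (πT p ≡ πT q × Adj G (πG p) (πG q)) ⊎ (πG p ≡ πG q × Adj T (πT p) (πT q))
  adj-split {p} {q} a with ∨-≡-true {⌊ πT p ≟ᶠ πT q ⌋ ∧ adj G (πG p) (πG q)} a
  ... | inj₁ h = let e , g = ∧-≡-true {⌊ πT p ≟ᶠ πT q ⌋} h in inj₁ (⌊⌋-true (πT p ≟ᶠ πT q) e , g)
  ... | inj₂ h = let e , t = ∧-≡-true {⌊ πG p ≟ᶠ πG q ⌋} h in inj₂ (⌊⌋-true (πG p ≟ᶠ πG q) e , t)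

  adj-G : ∀ x {u v} → Adj G u v → Adj K ⟦ u , x ⟧ ⟦ v , x ⟧
  adj-G x {u} {v} a rewrite adj-⟦⟧ u x v x | ⌊⌋-yes (x ≟ᶠ x) refl | a = refl

  adj-T : ∀ u {x y} → Adj T x y → Adj K ⟦ u , x ⟧ ⟦ u , y ⟧
  adj-T u {x} {y} a rewrite adj-⟦⟧ u x u y | ⌊⌋-yes (u ≟ᶠ u) refl | a = ∨-zeroʳ _


  adj-sym : ∀ {p q} → Adj K p q → Adj K q p
  adj-sym {p} {q} a with adj-split a
  ... | inj₁ (e , g) = subst₂ (Adj K) (⟦π⟧ q) (⟦π⟧-at {p} e) (adj-G (πT q) (simple⇒symmetric simpleG g))
  ... | inj₂ (e , t) = subst₂ (Adj K) (⟦π⟧ q) (trans (cong (λ w → ⟦ w , πT p ⟧) (sym e)) (⟦π⟧ p))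
                                (adj-T (πG q) (simple⇒symmetric simpleT t))

  irreflexiveT : ∀ {x} → ¬ Adj T x x
  irreflexiveT = simple⇒irreflexive simpleT

  lift-G : ∀ {S : VSet K} x {u v} → Reach G (λ w → S ⟦ w , x ⟧) u v → Reach K S ⟦ u , x ⟧ ⟦ v , x ⟧
  lift-G x (here s)     = here s
  lift-G x (step s a p) = step s (adj-G x a) (lift-G x p)

  lift-T : ∀ {S : VSet K} u {P : VSet T} → P ⊆ (λ y → S ⟦ u , y ⟧) →
           ∀ {x y} → Reach T P x y → Reach K S ⟦ u , x ⟧ ⟦ u , y ⟧
  lift-T u P⊆ (here s)     = here (P⊆ s)
  lift-T u P⊆ (step s a p) = step (P⊆ s) (adj-T u a) (lift-T u P⊆ p)

  project-G : ∀ {S : VSet K} x → (∀ p → πT p ≡ x) →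
              ∀ {p q} → Reach K S p q → Reach G (λ u → S ⟦ u , x ⟧) (πG p) (πG q)
  project-G {S} x all-x {p} (here s) = here (subst S (sym (⟦π⟧-at (all-x p))) s)
  project-G {S} x all-x {p} (step {w = q} s a r) with adj-split a
  ... | inj₁ (_ , g) = step (subst S (sym (⟦π⟧-at (all-x p))) s) g (project-G x all-x r)
  ... | inj₂ (_ , t) = ⊥-elim (irreflexiveT (subst₂ (Adj T) (all-x p) (all-x q) t))

  fibre-cycle : ∀ {S : VSet K} x → HasCycle K (λ p → S p × πT p ≡ x) → HasCycle G (λ u → S ⟦ u , x ⟧)
  fibre-cycle {S} x (p , ps , 2≤ , u , ss , l) =
    πG p , map πG ps ,
    subst (2 ≤_) (sym (length-map πG ps)) 2≤ ,
    unique-πG (All.map proj₂ ss) u ,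
    Allₚ.map⁺ (All.map (λ (s , e) → subst S (sym (⟦π⟧-at e)) s) ss) ,
    subst (λ t → Linked (Adj G) (πG p ∷ t)) (map-++ πG ps (p ∷ []))
          (linked-πG (Allₚ.++⁺ (All.map proj₂ ss) (proj₂ (All.head ss) ∷ [])) l)
    where
    unique-πG : ∀ {qs} → All (λ q → πT q ≡ x) qs → Unique qs → Unique (map πG qs)
    unique-πG []         []         = []
    unique-πG (e ∷ es) (q∉ ∷ u) = distinct e es q∉ ∷ unique-πG es u
      where
      distinct : ∀ {q qs} → πT q ≡ x → All (λ q → πT q ≡ x) qs → All (q ≢_) qs → All (πG q ≢_) (map πG qs)
      distinct e []         []         = []
      distinct e (e′ ∷ es) (q≢ ∷ q∉) = (λ eG → q≢ (π-injective eG (trans e (sym e′)))) ∷ distinct e es q∉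
    linked-πG : ∀ {qs} → All (λ q → πT q ≡ x) qs → Linked (Adj K) qs → Linked (Adj G) (map πG qs)
    linked-πG _                 []      = []
    linked-πG _                 [-]     = [-]
    linked-πG (e ∷ e′ ∷ es) (a ∷ l) with adj-split a
    ... | inj₁ (_ , g) = g ∷ linked-πG (e′ ∷ es) l
    ... | inj₂ (_ , t) = ⊥-elim (irreflexiveT (subst₂ (Adj T) e e′ t))

  layered : (V T → Coloring G) → Coloring K
  layered F p = F (πT p) (πG p)

  layered-⟦⟧ : ∀ F u x → layered F ⟦ u , x ⟧ ≡ F x u
  layered-⟦⟧ F u x = cong₂ F (πT-⟦⟧ u x) (πG-⟦⟧ u x)

  liftPair : Pair G → V T → Pair K
  liftPair ((a , b) , a≢b) x =
    (⟦ a , x ⟧ , ⟦ b , x ⟧) , λ e → a≢b (trans (sym (πG-⟦⟧ a x)) (trans (cong πG e) (πG-⟦⟧ b x)))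

  liftPair⁺ : ∀ P x {u} → InPair G P u → InPair K (liftPair P x) ⟦ u , x ⟧
  liftPair⁺ ((a , b) , _) x (inj₁ refl) = inj₁ refl
  liftPair⁺ ((a , b) , _) x (inj₂ refl) = inj₂ refl

  liftPair⁻ : ∀ P x {p} → InPair K (liftPair P x) p → πT p ≡ x × InPair G P (πG p)
  liftPair⁻ ((a , b) , _) x (inj₁ refl) = πT-⟦⟧ a x , inj₁ (πG-⟦⟧ a x)
  liftPair⁻ ((a , b) , _) x (inj₂ refl) = πT-⟦⟧ b x , inj₂ (πG-⟦⟧ b x)

  switch-layered : ∀ F P x p →
    switch K (layered F) (liftPair P x) p ≡ layered (updateAt F x (λ c → switch G c P)) p
  switch-layered F P x p with inPair? K (liftPair P x) p
  ... | yes p∈ = let e , πGp∈ = liftPair⁻ P x p∈ in begin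
    switch K (layered F) (liftPair P x) p  ≡⟨ switch-in K (layered F) (liftPair P x) p∈ ⟩
    not (F (πT p) (πG p))                  ≡⟨ cong (λ y → not (F y (πG p))) e ⟩
    not (F x (πG p))                       ≡⟨ switch-in G (F x) P πGp∈ ⟨
    switch G (F x) P (πG p)                ≡⟨ cong-app (updateAt-updates x F) (πG p) ⟨
    updateAt F x _ x (πG p)                ≡⟨ cong (λ y → updateAt F x _ y (πG p)) e ⟨
    layered (updateAt F x _) p             ∎
    where open ≡-Reasoning
  ... | no p∉ with πT p ≟ᶠ x
  ...   | no πTp≢x = trans (switch-out K (layered F) (liftPair P x) p∉)
                           (sym (cong-app (updateAt-minimal (πT p) x F πTp≢x) (πG p)))
  ...   | yes e = begin
    switch K (layered F) (liftPair P x) p  ≡⟨ switch-out K (layered F) (liftPair P x) p∉ ⟩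
    F (πT p) (πG p)                        ≡⟨ cong (λ y → F y (πG p)) e ⟩
    F x (πG p)                             ≡⟨ switch-out G (F x) P πGp∉ ⟨
    switch G (F x) P (πG p)                ≡⟨ cong-app (updateAt-updates x F) (πG p) ⟨
    updateAt F x _ x (πG p)                ≡⟨ cong (λ y → updateAt F x _ y (πG p)) e ⟨
    layered (updateAt F x _) p             ∎
    where
    open ≡-Reasoning
    πGp∉ : ¬ InPair G P (πG p)
    πGp∉ πGp∈ = p∉ (subst (InPair K (liftPair P x)) (⟦π⟧-at e) (liftPair⁺ P x πGp∈))

  module Layered (F : V T → Coloring G) (b : Bool) where

    Layer : VSet K
    Layer = Class K (layered F) b

    ∈-layer : ∀ {u x} → F x u ≡ b → Layer ⟦ u , x ⟧
    ∈-layer {u} {x} e = trans (layered-⟦⟧ F u x) e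

    layer-∈ : ∀ {u x} → Layer ⟦ u , x ⟧ → F x u ≡ b
    layer-∈ {u} {x} e = trans (sym (layered-⟦⟧ F u x)) e

    fibre-reach : ∀ x {u v} → Reach G (Class G (F x) b) u v → Reach K Layer ⟦ u , x ⟧ ⟦ v , x ⟧
    fibre-reach x = lift-G x ∘ Reach-mono G ∈-layer

    within : ∀ {x} → InducesTree G (Class G (F x) b) → ∀ {u v} → F x u ≡ b → F x v ≡ b →
             Reach K Layer ⟦ u , x ⟧ ⟦ v , x ⟧
    within {x} fibre-tree su sv = fibre-reach x (proj₁ (proj₂ fibre-tree) _ _ su sv)

    CrossedAtMostOnce : Set
    CrossedAtMostOnce = ∀ {u v x y} → Adj T x y → F x u ≡ b → F y u ≡ b → F x v ≡ b → F y v ≡ b → u ≡ v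

    layered-forest : (∀ x → InducesForest G (Class G (F x) b)) → CrossedAtMostOnce → InducesForest K Layer
    layered-forest fibres-forest crossed =
      fibration-forest edge-projects crossing-unique (Tree.nonBacktracking⇒unique T simpleT treeT) fibres
      where
      open Fibration K adj-sym Layer _≟ᶠ_ (Adj T) πT

      edge-projects : ∀ {p q} → Layer p → Layer q → Adj K p q → πT p ≡ πT q ⊎ Adj T (πT p) (πT q)
      edge-projects _ _ a = Sum.map proj₁ proj₂ (adj-split a)

      crossing-unique : ∀ {p q p′ q′} → Layer p → Layer q → Layer p′ → Layer q′ → Adj K p q → Adj K p′ q′ →
                        πT p ≡ πT p′ → πT q ≡ πT q′ → πT p ≢ πT q → p ≡ p′ × q ≡ q′
      crossing-unique {p} {q} {p′} {q′} sp sq sp′ sq′ a a′ e e′ πTp≢πTq with adj-split a | adj-split a′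
      ... | inj₁ (eT , _) | _              = ⊥-elim (πTp≢πTq eT)
      ... | inj₂ _        | inj₁ (eT′ , _) = ⊥-elim (πTp≢πTq (trans e (trans eT′ (sym e′))))
      ... | inj₂ (eG , t) | inj₂ (eG′ , _) = π-injective u≡v e , π-injective (trans (sym eG) (trans u≡v eG′)) e′
        where
        u≡v : πG p ≡ πG p′
        u≡v = crossed t sp (subst (λ w → F (πT q) w ≡ b) (sym eG) sq)
                         (subst (λ y → F y (πG p′) ≡ b) (sym e) sp′)
                         (subst₂ (λ y w → F y w ≡ b) (sym e′) (sym eG′) sq′)

      fibres : ∀ x → InducesForest K (Fibre x)
      fibres x = InducesForest-anti G layer-∈ (fibres-forest x) ∘ fibre-cycle x

    layered-tree : (∀ x → InducesTree G (Class G (F x) b)) → ∀ h → (∀ x → F x h ≡ b) → CrossedAtMostOnce →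
                   InducesTree K Layer
    layered-tree fibres-tree h hub crossed =
      (⟦ h , root ⟧ , ∈-layer (hub root)) , connected ,
      layered-forest (λ x → proj₂ (proj₂ (fibres-tree x))) crossed
      where
      root = proj₁ (proj₁ treeT)
      connected : ∀ p q → Layer p → Layer q → Reach K Layer p q
      connected p q sp sq = subst₂ (Reach K Layer) (⟦π⟧ p) (⟦π⟧ q)
        (Reach-trans K (within (fibres-tree (πT p)) sp (hub (πT p)))
          (Reach-trans K (lift-T h (λ {y} _ → ∈-layer (hub y)) (Tree.connected T simpleT treeT (πT p) (πT q)))
            (within (fibres-tree (πT q)) (hub (πT q)) sq)))

-- The construction

module QuartetFacts (G : Graph) (C : Coloring G) (hamC : IsHamiltonianColoring G C)
                    (I J : Pair G) (quartet : IsQuartet G C I J) where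

  I∩J≡∅ : Disjoint G I J
  I∩J≡∅ = proj₁ quartet

  separatesI : Separates G C I
  separatesI = proj₁ (proj₂ quartet)

  separatesJ : Separates G C J
  separatesJ = proj₁ (proj₂ (proj₂ quartet))

  CI CJ : Coloring G
  CI = switch G C I
  CJ = switch G C J

  hamCI : IsHamiltonianColoring G CI
  hamCI = proj₁ (proj₂ (proj₂ (proj₂ quartet)))

  twoCJ : ∀ b → TwoComponents G (Class G CJ b) I J
  twoCJ = proj₂ (proj₂ (proj₂ (proj₂ quartet)))

  i j : Bool → V G
  i = member G C I
  j = member G C J

  i∈I : ∀ {b} → InPair G I (i b)
  i∈I = member-∈ G C I _

  j∈J : ∀ {b} → InPair G J (j b)
  j∈J = member-∈ G C J _

  C-i : ∀ b → C (i b) ≡ b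
  C-i = member-color G C I separatesI

  C-j : ∀ b → C (j b) ≡ b
  C-j = member-color G C J separatesJ

  CI-out : ∀ {u} → ¬ InPair G I u → CI u ≡ C u
  CI-out = switch-out G C I

  CJ-out : ∀ {u} → ¬ InPair G J u → CJ u ≡ C u
  CJ-out = switch-out G C J

  layerColoring : Parity → Coloring G
  layerColoring 0ℙ = C
  layerColoring 1ℙ = not ∘ CI

  layerColoring-hamiltonian : ∀ p → IsHamiltonianColoring G (layerColoring p)
  layerColoring-hamiltonian 0ℙ     = hamC
  layerColoring-hamiltonian 1ℙ b = InducesTree-resp G
    ((λ e → trans (cong not e) (not-involutive b)) , (λ e → trans (sym (not-involutive _)) (cong not e)))
    (hamCI (not b))

  layerColoring-I : ∀ p {u} → InPair G I u → layerColoring p u ≡ C u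
  layerColoring-I 0ℙ _   = refl
  layerColoring-I 1ℙ u∈I = trans (cong not (switch-in G C I u∈I)) (not-involutive _)

  layerColoring-hub : ∀ p b → layerColoring p (i b) ≡ b
  layerColoring-hub p b = trans (layerColoring-I p i∈I) (C-i b)

  layerColorings-agree : ∀ p {u b} → layerColoring p u ≡ b → layerColoring (p ⁻¹) u ≡ b → u ≡ i b
  layerColorings-agree p {u} e e′ with inPair? G I u
  ... | yes u∈I = member-unique G C I separatesI u∈I (trans (sym (layerColoring-I p u∈I)) e)
  ... | no u∉I  = ⊥-elim (not-¬ refl (differ p (trans e (sym e′))))
    where
    differ : ∀ p → layerColoring p u ≡ layerColoring (p ⁻¹) u → C u ≡ not (C u)
    differ 0ℙ e = trans e (cong not (CI-out u∉I))
    differ 1ℙ e = trans (sym e) (cong not (CI-out u∉I))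

  switch-layerColoring : ∀ p u → switch G (layerColoring p) I u ≡ not (layerColoring (p ⁻¹) u)
  switch-layerColoring 0ℙ u = sym (not-involutive _)
  switch-layerColoring 1ℙ u with inPair? G I u
  ... | yes u∈I = trans (switch-in G (layerColoring 1ℙ) I u∈I) (trans (not-involutive _) (switch-in G C I u∈I))
  ... | no u∉I  = trans (switch-out G (layerColoring 1ℙ) I u∉I) (cong not (CI-out u∉I))

  CJ-i : ∀ b → CJ (i b) ≡ b
  CJ-i b = trans (CJ-out (I∩J≡∅ _ i∈I)) (C-i b)

  CJ-agrees-with-layer₁ : ∀ {u b} → CJ u ≡ b → layerColoring 1ℙ u ≡ b → u ≡ i b ⊎ u ≡ j (not b)
  CJ-agrees-with-layer₁ {u} {b} e e′ with inPair? G I u | inPair? G J u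
  ... | yes u∈I | _       = inj₁ (member-unique G C I separatesI u∈I (trans (sym (CJ-out (I∩J≡∅ u u∈I))) e))
  ... | no u∉I  | yes u∈J = inj₂ (member-unique G C J separatesJ u∈J (not-≡-swap (not-C≡b u∉I)))
    where
    not-C≡b : ¬ InPair G I u → not (C u) ≡ b
    not-C≡b u∉I = trans (cong not (sym (CI-out u∉I))) e′
  ... | no u∉I  | no u∉J  = ⊥-elim (not-¬ refl (trans (trans (sym (CJ-out u∉J)) e) (sym not-C≡b)))
    where
    not-C≡b : not (C u) ≡ b
    not-C≡b = trans (cong not (sym (CI-out u∉I))) e′

module TwoLeaves (G T : Graph) (simpleG : IsSimple G) (simpleT : IsSimple T) (treeT : IsTree T)
  (C : Coloring G) (hamC : IsHamiltonianColoring G C) (I J : Pair G) (quartet : IsQuartet G C I J)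
  {r s r′ s′ : V T} (leaf : Leaf T r s) (leaf′ : Leaf T r′ s′) (r≢r′ : r ≢ r′) where

  open Product G T simpleG simpleT treeT
  open QuartetFacts G C hamC I J quartet
  open Tree.Rooted T simpleT treeT r

  F : V T → Coloring G
  F x = layerColoring (side x)

  F-r : ∀ u → F r u ≡ C u
  F-r u = cong (λ p → layerColoring p u) side-root

  F-tree : ∀ x b → InducesTree G (Class G (F x) b)
  F-tree x = layerColoring-hamiltonian (side x)

  F-hub : ∀ x b → F x (i b) ≡ b
  F-hub x = layerColoring-hub (side x)

  F-agree : ∀ {x y u b} → Adj T x y → F x u ≡ b → F y u ≡ b → u ≡ i b
  F-agree {x} {b = b} x~y e e′ =
    layerColorings-agree (side x) e (subst (λ p → layerColoring p _ ≡ b) (side-adj x~y) e′)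

  F-crossed : ∀ b → Layered.CrossedAtMostOnce F b
  F-crossed b x~y eu eu′ ev ev′ = trans (F-agree x~y eu eu′) (sym (F-agree x~y ev ev′))

  A : Coloring K
  A = layered F

  A-hamiltonian : IsHamiltonianColoring K A
  A-hamiltonian b = Layered.layered-tree F b (λ x → F-tree x b) (i b) (λ x → F-hub x b) (F-crossed b)

  I′ J′ : Pair K
  I′ = liftPair J r
  J′ = liftPair I r′

  s′≢r′ : s′ ≢ r′
  s′≢r′ refl = simple⇒irreflexive simpleT (proj₁ leaf′)

  F₃ : V T → Coloring G
  F₃ = updateAt F r′ (λ c → switch G c I)

  F₃-r′ : ∀ u → F₃ r′ u ≡ not (F s′ u)
  F₃-r′ u = begin
    F₃ r′ u                                ≡⟨ cong-app (updateAt-updates r′ F) u ⟩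
    switch G (F r′) I u                    ≡⟨ switch-layerColoring (side r′) u ⟩
    not (layerColoring (side r′ ⁻¹) u)     ≡⟨ cong (λ p → not (layerColoring p u)) (side-adj (proj₁ leaf′)) ⟨
    not (F s′ u)                           ∎
    where open ≡-Reasoning

  F₃-other : ∀ {x} u → x ≢ r′ → F₃ x u ≡ F x u
  F₃-other {x} u x≢r′ = cong-app (updateAt-minimal x r′ F x≢r′) u

  module Q3 (b : Bool) where
    open Layered F₃ b

    r′-isolated : ∀ {u} → F₃ r′ u ≡ b → F₃ s′ u ≡ b → ⊥
    r′-isolated {u} e e′ =
      not-¬ refl (trans (sym (trans (sym (F₃-other u s′≢r′)) e′)) (not-≡-swap (trans (sym (F₃-r′ u)) e)))

    fibre-tree : ∀ x → InducesTree G (Class G (F₃ x) b)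
    fibre-tree x with x ≟ᶠ r′
    ... | yes refl = InducesTree-resp G
      ((λ e → trans (F₃-r′ _) (trans (cong not e) (not-involutive b))) , λ e → not-≡-swap (trans (sym (F₃-r′ _)) e))
      (F-tree s′ (not b))
    ... | no x≢r′ = InducesTree-resp G ((λ e → trans (F₃-other _ x≢r′) e) , λ e → trans (sym (F₃-other _ x≢r′)) e)
      (F-tree x b)

    off-r′ : ∀ {x u} → x ≢ r′ → F₃ x u ≡ b → F x u ≡ b
    off-r′ x≢r′ e = trans (sym (F₃-other _ x≢r′)) e

    crossed : CrossedAtMostOnce
    crossed {u} {v} {x} {y} x~y eu eu′ ev ev′ with x ≟ᶠ r′ | y ≟ᶠ r′
    ... | yes refl | _        = ⊥-elim (r′-isolated eu (subst (λ z → F₃ z u ≡ b) (proj₂ leaf′ y x~y) eu′))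
    ... | no _     | yes refl =
      ⊥-elim (r′-isolated eu′ (subst (λ z → F₃ z u ≡ b) (proj₂ leaf′ x (simple⇒symmetric simpleT x~y)) eu))
    ... | no x≢r′  | no y≢r′  =
      F-crossed b x~y (off-r′ x≢r′ eu) (off-r′ y≢r′ eu′) (off-r′ x≢r′ ev) (off-r′ y≢r′ ev′)

    a₃ b₃ : V K
    a₃ = ⟦ j b , r ⟧
    b₃ = ⟦ i (not b) , r′ ⟧

    a₃∈ : Layer a₃
    a₃∈ = ∈-layer (trans (F₃-other (j b) r≢r′) (trans (F-r (j b)) (C-j b)))

    b₃∈ : Layer b₃
    b₃∈ = ∈-layer (trans (F₃-r′ _) (trans (cong not (F-hub s′ (not b))) (not-involutive b)))

    leaves-r′ : ∀ {p q} → Layer p → Layer q → Adj K p q → πT p ≢ r′ → πT q ≢ r′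
    leaves-r′ {p} {q} sp sq p~q πTp≢r′ πTq≡r′ with adj-split p~q
    ... | inj₁ (eT , _)    = πTp≢r′ (trans eT πTq≡r′)
    ... | inj₂ (eG , πT~) =
      r′-isolated (subst₂ (λ y w → F₃ y w ≡ b) πTq≡r′ (sym eG) sq)
                  (subst (λ y → F₃ y (πG p) ≡ b) πTp≡s′ sp)
      where
      πTp≡s′ : πT p ≡ s′
      πTp≡s′ = proj₂ leaf′ (πT p) (simple⇒symmetric simpleT (subst (Adj T _) πTq≡r′ πT~))

    a₃↛b₃ : ¬ Reach K Layer a₃ b₃
    a₃↛b₃ w = Reach-invariant K (λ p → πT p ≢ r′) leaves-r′ w
               (λ e → r≢r′ (trans (sym (πT-⟦⟧ (j b) r)) e)) (πT-⟦⟧ (i (not b)) r′)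

    reaches-a₃-or-b₃ : ∀ v → Layer v → Reach K Layer v a₃ ⊎ Reach K Layer v b₃
    reaches-a₃-or-b₃ v sv with πT v ≟ᶠ r′
    ... | yes e = inj₂ (subst (λ z → Reach K Layer z b₃) (⟦π⟧-at e)
                          (within (fibre-tree r′) (subst (λ y → F₃ y (πG v) ≡ b) e sv) (layer-∈ b₃∈)))
    ... | no x≢r′ = inj₁ (subst (λ z → Reach K Layer z a₃) (⟦π⟧ v)
      (Reach-trans K (within (fibre-tree (πT v)) sv (hub-off-r′ x≢r′))
      (Reach-trans K (lift-T (i b) (∈-layer ∘ hub-off-r′) (Tree.avoidLeaf T simpleT treeT leaf′ x≢r′ r≢r′))
                     (within (fibre-tree r) (hub-off-r′ r≢r′) (layer-∈ a₃∈)))))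
      where
      hub-off-r′ : ∀ {y} → y ≢ r′ → F₃ y (i b) ≡ b
      hub-off-r′ y≢r′ = trans (F₃-other _ y≢r′) (F-hub _ b)

    two : TwoComponents K Layer I′ J′
    two = layered-forest (λ x → proj₂ (proj₂ (fibre-tree x))) crossed ,
          a₃ , b₃ , liftPair⁺ J r j∈J , liftPair⁺ I r′ i∈I , a₃∈ , b₃∈ , a₃↛b₃ , reaches-a₃-or-b₃

  s≢r : s ≢ r
  s≢r refl = simple⇒irreflexive simpleT (proj₁ leaf)

  side-s : side s ≡ 1ℙ
  side-s = trans (side-adj (proj₁ leaf)) (cong _⁻¹ side-root)

  F₂ : V T → Coloring G
  F₂ = updateAt F r (λ c → switch G c J)

  F₂-r : ∀ u → F₂ r u ≡ CJ u
  F₂-r u = trans (cong-app (updateAt-updates r F) u) (cong (λ p → switch G (layerColoring p) J u) side-root)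

  F₂-other : ∀ {x} u → x ≢ r → F₂ x u ≡ F x u
  F₂-other {x} u x≢r = cong-app (updateAt-minimal x r F x≢r) u

  module Q2 (b : Bool) {a₂ b₂ : V G} (forestJ : InducesForest G (Class G CJ b))
            (a₂∈I : InPair G I a₂) (b₂∈J : InPair G J b₂) (CJ-a₂ : CJ a₂ ≡ b) (CJ-b₂ : CJ b₂ ≡ b)
            (a₂↛b₂ : ¬ Reach G (Class G CJ b) a₂ b₂)
            (to-a₂-or-b₂ : ∀ v → CJ v ≡ b → Reach G (Class G CJ b) v a₂ ⊎ Reach G (Class G CJ b) v b₂) where
    open Layered F₂ b

    a₂≡i : a₂ ≡ i b
    a₂≡i = member-unique G C I separatesI a₂∈I (trans (sym (CJ-out (I∩J≡∅ _ a₂∈I))) CJ-a₂)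

    C-b₂ : C b₂ ≡ not b
    C-b₂ = not-≡-swap (trans (sym (switch-in G C J b₂∈J)) CJ-b₂)

    b₂≡j : b₂ ≡ j (not b)
    b₂≡j = member-unique G C J separatesJ b₂∈J C-b₂

    ∈-layer-r : ∀ {u} → CJ u ≡ b → Layer ⟦ u , r ⟧
    ∈-layer-r e = ∈-layer (trans (F₂-r _) e)

    layer-r-∈ : ∀ {p} → Layer p → πT p ≡ r → CJ (πG p) ≡ b
    layer-r-∈ {p} sp e = trans (sym (F₂-r _)) (subst (λ y → F₂ y (πG p) ≡ b) e sp)

    F₂-tree : ∀ {x} → x ≢ r → InducesTree G (Class G (F₂ x) b)
    F₂-tree x≢r = InducesTree-resp G ((λ e → trans (F₂-other _ x≢r) e) , λ e → trans (sym (F₂-other _ x≢r)) e)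
      (F-tree _ b)

    hub-line : ∀ y → F₂ y (i b) ≡ b
    hub-line y with y ≟ᶠ r
    ... | yes refl = trans (F₂-r _) (CJ-i b)
    ... | no y≢r   = trans (F₂-other _ y≢r) (F-hub y b)

    hub : V K
    hub = ⟦ i b , r ⟧

    to-hub-off-r : ∀ {p} → πT p ≢ r → Layer p → Reach K Layer p hub
    to-hub-off-r {p} πTp≢r sp = subst (λ z → Reach K Layer z hub) (⟦π⟧ p)
      (Reach-trans K (within (F₂-tree πTp≢r) sp (hub-line _))
                     (lift-T (i b) (λ {y} _ → ∈-layer (hub-line y)) (Tree.connected T simpleT treeT (πT p) r)))

    b₂-at-s : F₂ s b₂ ≡ b
    b₂-at-s = begin
      F₂ s b₂                   ≡⟨ F₂-other b₂ s≢r ⟩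
      layerColoring (side s) b₂ ≡⟨ cong (λ p → layerColoring p b₂) side-s ⟩
      not (CI b₂)               ≡⟨ cong not (CI-out (λ b₂∈I → I∩J≡∅ b₂ b₂∈I b₂∈J)) ⟩
      not (C b₂)                ≡⟨ cong not C-b₂ ⟩
      not (not b)               ≡⟨ not-involutive b ⟩
      b                         ∎
      where open ≡-Reasoning

    to-hub : ∀ {p} → Layer p → Reach K Layer p hub
    to-hub {p} sp with πT p ≟ᶠ r
    ... | no πTp≢r = to-hub-off-r πTp≢r sp
    ... | yes e with to-a₂-or-b₂ (πG p) (layer-r-∈ sp e)
    ...   | inj₁ to-a₂ = subst₂ (Reach K Layer) (⟦π⟧-at e) (cong (λ u → ⟦ u , r ⟧) a₂≡i)
                           (lift-G r (Reach-mono G ∈-layer-r to-a₂))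
    ...   | inj₂ to-b₂ = subst (λ z → Reach K Layer z hub) (⟦π⟧-at e)
                           (Reach-trans K (Reach-∷ʳ K (lift-G r (Reach-mono G ∈-layer-r to-b₂)) (adj-T b₂ (proj₁ leaf))
                                                     (∈-layer b₂-at-s))
                                          (to-hub-off-r (λ e′ → s≢r (trans (sym (πT-⟦⟧ b₂ s)) e′)) (∈-layer b₂-at-s)))

    reach-sym : ∀ {u v} → Reach G (Class G CJ b) u v → Reach G (Class G CJ b) v u
    reach-sym = Reach-sym G (simple⇒symmetric simpleG)

    towards-b₂ : V G → Bool
    towards-b₂ u with CJ u ≟𝔹 b
    ... | no _ = false
    ... | yes e with to-a₂-or-b₂ u e
    ...   | inj₁ _ = false
    ...   | inj₂ _ = true

    towards-b₂-true : ∀ {u} → towards-b₂ u ≡ true → Reach G (Class G CJ b) u b₂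
    towards-b₂-true {u} t with CJ u ≟𝔹 b
    ... | yes e with to-a₂-or-b₂ u e
    ...   | inj₂ to-b₂ = to-b₂

    towards-b₂-false : ∀ {u} → CJ u ≡ b → towards-b₂ u ≡ false → Reach G (Class G CJ b) u a₂
    towards-b₂-false {u} CJu≡b f with CJ u ≟𝔹 b
    ... | no CJu≢b = ⊥-elim (CJu≢b CJu≡b)
    ... | yes e with to-a₂-or-b₂ u e
    ...   | inj₁ to-a₂ = to-a₂

    a₂-side : towards-b₂ (i b) ≡ false
    a₂-side = ¬-not (λ t → a₂↛b₂ (subst (λ u → Reach G _ u b₂) (sym a₂≡i) (towards-b₂-true t)))

    b₂-side : towards-b₂ (j (not b)) ≡ true
    b₂-side = ¬-not λ f → a₂↛b₂ (reach-sym (subst (λ u → Reach G _ u a₂) (sym b₂≡j)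
                              (towards-b₂-false (subst (λ u → CJ u ≡ b) b₂≡j CJ-b₂) f)))

    same-side : ∀ {u v} → CJ u ≡ b → CJ v ≡ b → Adj G u v → towards-b₂ u ≡ false → towards-b₂ v ≡ false
    same-side CJu CJv u~v f = ¬-not λ t →
      a₂↛b₂ (Reach-trans G (reach-sym (towards-b₂-false CJu f)) (step CJu u~v (towards-b₂-true t)))

    r-fibre-forest : InducesForest K (λ p → Layer p × πT p ≡ r)
    r-fibre-forest = InducesForest-anti G (λ e → trans (sym (F₂-r _)) (layer-∈ e)) forestJ ∘ fibre-cycle r

    leaving-r : ∀ {p q} → Layer p → Layer q → Adj K p q → πT p ≡ r → πT q ≢ r →
                ∃ λ u → p ≡ ⟦ u , r ⟧ × q ≡ ⟦ u , s ⟧ × (u ≡ i b ⊎ u ≡ j (not b))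
    leaving-r {p} {q} sp sq p~q πTp≡r πTq≢r with adj-split p~q
    ... | inj₁ (eT , _) = ⊥-elim (πTq≢r (trans (sym eT) πTp≡r))
    ... | inj₂ (eG , t) = πG p , sym (⟦π⟧-at πTp≡r) , sym (trans (cong (λ u → ⟦ u , s ⟧) eG) (⟦π⟧-at πTq≡s)) ,
                          CJ-agrees-with-layer₁ (layer-r-∈ sp πTp≡r) layer₁
      where
      πTq≡s : πT q ≡ s
      πTq≡s = proj₂ leaf (πT q) (subst (λ y → Adj T y (πT q)) πTp≡r t)
      layer₁ : layerColoring 1ℙ (πG p) ≡ b
      layer₁ = trans (cong (λ x → layerColoring x (πG p)) (sym side-s))
                     (trans (sym (F₂-other _ s≢r)) (subst₂ (λ y w → F₂ y w ≡ b) πTq≡s (sym eG) sq))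

    on-a₂-side in-r : V K → Bool
    on-a₂-side p = ⌊ πT p ≟ᶠ r ⌋ ∧ not (towards-b₂ (πG p))
    in-r p = ⌊ πT p ≟ᶠ r ⌋

    on-a₂-side-true : ∀ {p} → on-a₂-side p ≡ true → πT p ≡ r × towards-b₂ (πG p) ≡ false
    on-a₂-side-true {p} e =
      let e₁ , e₂ = ∧-≡-true {⌊ πT p ≟ᶠ r ⌋} e in ⌊⌋-true (πT p ≟ᶠ r) e₁ , not-≡-swap e₂

    on-a₂-side-false : ∀ {p} → on-a₂-side p ≡ false → πT p ≡ r → towards-b₂ (πG p) ≡ true
    on-a₂-side-false {p} f e = not-≡-swap (trans (cong (_∧ not (towards-b₂ (πG p))) (sym (⌊⌋-yes (πT p ≟ᶠ r) e))) f)

    in-r-false : ∀ {p} → in-r p ≡ false → πT p ≢ r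
    in-r-false {p} f e = case trans (sym f) (⌊⌋-yes (πT p ≟ᶠ r) e) of λ ()

    πG-≡ : ∀ {p u x} → p ≡ ⟦ u , x ⟧ → πG p ≡ u
    πG-≡ {u = u} {x} refl = πG-⟦⟧ u x

    a₂-bridge : ∀ {p q} → Layer p → Layer q → Adj K p q → on-a₂-side p ≡ true → on-a₂-side q ≡ false →
                p ≡ ⟦ i b , r ⟧ × q ≡ ⟦ i b , s ⟧
    a₂-bridge {p} {q} sp sq p~q gp gq = by-copy-of-q (πT q ≟ᶠ r)
      where
      πTp≡r = proj₁ (on-a₂-side-true gp)
      p-a₂  = proj₂ (on-a₂-side-true gp)
      by-copy-of-q : Dec (πT q ≡ r) → p ≡ ⟦ i b , r ⟧ × q ≡ ⟦ i b , s ⟧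
      by-copy-of-q (yes πTq≡r) with adj-split p~q
      ... | inj₁ (_ , g) = case trans (sym (on-a₂-side-false gq πTq≡r))
                                      (same-side (layer-r-∈ sp πTp≡r) (layer-r-∈ sq πTq≡r) g p-a₂) of λ ()
      ... | inj₂ (_ , t) = ⊥-elim (simple⇒irreflexive simpleT (subst₂ (Adj T) πTp≡r πTq≡r t))
      by-copy-of-q (no πTq≢r) with leaving-r sp sq p~q πTp≡r πTq≢r
      ... | u , p≡ , q≡ , inj₁ refl = p≡ , q≡
      ... | u , p≡ , q≡ , inj₂ refl = case trans (sym b₂-side) (trans (cong towards-b₂ (sym (πG-≡ p≡))) p-a₂) of λ ()

    b₂-bridge : ∀ {p q} → Layer p → Layer q → Adj K p q → in-r p ≡ true → on-a₂-side p ≡ false → in-r q ≡ false →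
                p ≡ ⟦ j (not b) , r ⟧ × q ≡ ⟦ j (not b) , s ⟧
    b₂-bridge {p} {q} sp sq p~q gp gp′ gq with leaving-r sp sq p~q (⌊⌋-true (πT p ≟ᶠ r) gp) (in-r-false gq)
    ... | u , p≡ , q≡ , inj₂ refl = p≡ , q≡
    ... | u , p≡ , q≡ , inj₁ refl =
      case trans (sym a₂-side) (trans (cong towards-b₂ (sym (πG-≡ p≡)))
                                      (on-a₂-side-false gp′ (⌊⌋-true (πT p ≟ᶠ r) gp))) of λ ()

    same-endpoints : ∀ {p q p′ q′ c d : V K} → p ≡ c × q ≡ d → p′ ≡ c × q′ ≡ d → p ≡ p′ × q ≡ q′
    same-endpoints (refl , refl) (refl , refl) = refl , refl

    A-forest : InducesForest K (Layered.Layer F b)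
    A-forest = Layered.layered-forest F b (λ x → proj₂ (proj₂ (F-tree x b))) (F-crossed b)

    off-a₂-side-forest : InducesForest K (λ p → Layer p × on-a₂-side p ≡ false)
    off-a₂-side-forest = forest-glue K adj-sym _ in-r
      (InducesForest-anti K (λ ((sp , _) , g) → sp , ⌊⌋-true (πT _ ≟ᶠ r) g) r-fibre-forest)
      (InducesForest-anti K (λ ((sp , _) , g) → trans (sym (F₂-other _ (in-r-false g))) sp) A-forest)
      (λ (sp , gp) (sq , _) (sp′ , gp′) (sq′ , _) a a′ rp rq rp′ rq′ →
         same-endpoints (b₂-bridge sp sq a rp gp rq) (b₂-bridge sp′ sq′ a′ rp′ gp′ rq′))

    -- the copy at r splits into the components of a₂ = i b and b₂ = j (not b), glued to the rest
    -- by the edges from ⟦ i b , r ⟧ and ⟦ j (not b) , r ⟧ to the copy at s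
    forest : InducesForest K Layer
    forest = forest-glue K adj-sym Layer on-a₂-side
      (InducesForest-anti K (λ (sp , g) → sp , proj₁ (on-a₂-side-true g)) r-fibre-forest)
      off-a₂-side-forest
      (λ sp sq sp′ sq′ a a′ gp gq gp′ gq′ →
         same-endpoints (a₂-bridge sp sq a gp gq) (a₂-bridge sp′ sq′ a′ gp′ gq′))

    tree : InducesTree K Layer
    tree = hub-tree K adj-sym (∈-layer (hub-line r)) to-hub forest

  A-r : ∀ u → A ⟦ u , r ⟧ ≡ C u
  A-r u = trans (layered-⟦⟧ F u r) (F-r u)

  A-r′ : ∀ {u} → InPair G I u → A ⟦ u , r′ ⟧ ≡ C u
  A-r′ {u} u∈I = trans (layered-⟦⟧ F u r′) (layerColoring-I (side r′) u∈I)

  A-quartet : IsQuartet K A I′ J′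
  A-quartet =
    (λ v v∈I′ v∈J′ → r≢r′ (trans (sym (proj₁ (liftPair⁻ J r v∈I′))) (proj₁ (liftPair⁻ I r′ v∈J′)))) ,
    (λ e → separatesJ (trans (sym (A-r _)) (trans e (A-r _)))) ,
    (λ e → separatesI (trans (sym (A-r′ (inj₁ refl))) (trans e (A-r′ (inj₂ refl))))) ,
    (λ b → InducesTree-resp K (class-resp K (sym ∘ switch-layered F J r) b) (Q2-tree b (twoCJ b))) ,
    (λ b → TwoComponents-resp K {I = I′} {J′} (class-resp K (sym ∘ switch-layered F I r′) b) (Q3.two b))
    where
    Q2-tree : ∀ b → TwoComponents G (Class G CJ b) I J → InducesTree K (Layered.Layer F₂ b)
    Q2-tree b (forestJ , _ , _ , a₂∈I , b₂∈J , CJ-a₂ , CJ-b₂ , a₂↛b₂ , to-a₂-or-b₂) =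
      Q2.tree b forestJ a₂∈I b₂∈J CJ-a₂ CJ-b₂ a₂↛b₂ to-a₂-or-b₂

  result : HasHamColoringWithQuartet K
  result = A , A-hamiltonian , I′ , J′ , A-quartet

module OneVertex (G T : Graph) (simpleG : IsSimple G) (simpleT : IsSimple T) (treeT : IsTree T)
  (C : Coloring G) (hamC : IsHamiltonianColoring G C) (I J : Pair G) (quartet : IsQuartet G C I J)
  {x₀ : V T} (only : ∀ y → y ≡ x₀) where

  open Product G T simpleG simpleT treeT
  open QuartetFacts G C hamC I J quartet

  no-T-edges : ∀ c b → Layered.CrossedAtMostOnce (λ _ → c) b
  no-T-edges c b {x = x} {y} x~y =
    ⊥-elim (simple⇒irreflexive simpleT (subst (Adj T x) (trans (only y) (sym (only x))) x~y))

  lift-tree : ∀ {c} b → InducesTree G (Class G c b) → InducesTree K (Layered.Layer (λ _ → c) b)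
  lift-tree {c} b tree =
    Layered.layered-tree (λ _ → c) b (λ _ → tree) (proj₁ (proj₁ tree)) (λ _ → proj₂ (proj₁ tree)) (no-T-edges c b)

  lift-two : ∀ {c b P Q} → TwoComponents G (Class G c b) P Q →
             TwoComponents K (Layered.Layer (λ _ → c) b) (liftPair P x₀) (liftPair Q x₀)
  lift-two {c} {b} {P} {Q} (forest , a , a′ , a∈P , a′∈Q , ca , ca′ , a↛a′ , to-a-or-a′) =
    layered-forest (λ _ → forest) (no-T-edges c b) ,
    ⟦ a , x₀ ⟧ , ⟦ a′ , x₀ ⟧ , liftPair⁺ P x₀ a∈P , liftPair⁺ Q x₀ a′∈Q , ∈-layer ca , ∈-layer ca′ ,
    (λ w → a↛a′ (subst₂ (Reach G _) (πG-⟦⟧ a x₀) (πG-⟦⟧ a′ x₀)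
                          (Reach-mono G layer-∈ (project-G x₀ (only ∘ πT) w)))) ,
    λ v sv → Sum.map (lift v) (lift v) (to-a-or-a′ (πG v) sv)
    where
    open Layered (λ _ → c) b
    lift : ∀ v {u} → Reach G (Class G c b) (πG v) u → Reach K Layer v ⟦ u , x₀ ⟧
    lift v w = subst (λ z → Reach K Layer z _) (⟦π⟧-at (only (πT v))) (fibre-reach x₀ w)

  A : Coloring K
  A = layered (λ _ → C)

  switch-A : ∀ P p → switch K A (liftPair P x₀) p ≡ layered (λ _ → switch G C P) p
  switch-A P p = trans (switch-layered (λ _ → C) P x₀ p)
    (trans (cong (λ y → updateAt (λ _ → C) x₀ (λ c → switch G c P) y (πG p)) (only (πT p)))
           (cong-app (updateAt-updates x₀ (λ _ → C)) (πG p)))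

  A-⟦⟧ : ∀ u → A ⟦ u , x₀ ⟧ ≡ C u
  A-⟦⟧ u = layered-⟦⟧ (λ _ → C) u x₀

  result : HasHamColoringWithQuartet K
  result = A , (λ b → lift-tree b (hamC b)) , liftPair I x₀ , liftPair J x₀ ,
    (λ v v∈I v∈J → I∩J≡∅ (πG v) (proj₂ (liftPair⁻ I x₀ v∈I)) (proj₂ (liftPair⁻ J x₀ v∈J))) ,
    (λ e → separatesI (trans (sym (A-⟦⟧ _)) (trans e (A-⟦⟧ _)))) ,
    (λ e → separatesJ (trans (sym (A-⟦⟧ _)) (trans e (A-⟦⟧ _)))) ,
    (λ b → InducesTree-resp K (class-resp K (sym ∘ switch-A I) b) (lift-tree b (hamCI b))) ,
    (λ b → TwoComponents-resp K {I = liftPair I x₀} {liftPair J x₀} (class-resp K (sym ∘ switch-A J) b)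
                               (lift-two {P = I} {J} (twoCJ b)))

theorem2 : (G T : Graph) → IsSimple G → IsConnected G → IsSimple T → IsTree T →
    HasHamColoringWithQuartet G → HasHamColoringWithQuartet (G ×ᴳ T)
theorem2 G T simpleG _ simpleT treeT (C , hamC , I , J , quartet) with any? (λ y → ¬? (y ≟ᶠ x₀))
  where x₀ = proj₁ (proj₁ treeT)
... | yes (y , y≢x₀) =
  let _ , _ , _ , _ , leaf , leaf′ , r≢r′ = Tree.twoLeaves T simpleT treeT (y≢x₀ ∘ sym)
  in TwoLeaves.result G T simpleG simpleT treeT C hamC I J quartet leaf leaf′ r≢r′
... | no none = OneVertex.result G T simpleG simpleT treeT C hamC I J quartet
                  (λ y → decidable-stable (y ≟ᶠ _) (λ y≢x₀ → none (y , y≢x₀)))
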